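{- Let $\mathcal{C}=\{K^s_{s,N}: s\in\mathbb{N},\ N\in\mathbb{N}\}$. Then $\mathcal{C}$ is not strongly flip-flat.
   Context: $K_{s,N}$ is the complete bipartite graph with sides of sizes $s$ and $N$. For a graph $G$, $G^s$ denotes its $s$-subdivision: each edge $uv$ is replaced by a path from $u$ to $v$ of length $s+1$ whose internal vertices are new. A set $B$ of vertices is $r$-independent in a graph if its distinct vertices are pairwise at distance $>r$. A flip in $G$ is a pair $(A,B)$ of vertex subsets; $G\oplus(A,B)$ has edge set $E(G)\,\Delta\,((A\times B)\cup(B\times A))$, and $G\oplus\{F_1,\dots,F_k\}=G\oplus F_1\oplus\cdots\oplus F_k$. A class $\mathcal{C}$ is strongly flip-flat if there is an integer $s_0$ such that for every $r\in\mathbb{N}$ there is $N_r:\mathbb{N}\to\mathbb{N}$ such that for all $m\in\mathbb{N}$, all $G\in\mathcal{C}$ and all $A\subseteq V(G)$ with $|A|\ge N_r(m)$ there are a set $\mathcal{F}$ of at most $s_0$ flips and $B\subseteq A$ with $|B|\ge m$ that is $r$-independent in $G\oplus\mathcal{F}$. -}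

module Defs where

open import Data.Nat using (ℕ; zero; suc; _+_; _*_; _≤_; _≡ᵇ_)
open import Data.Bool using (Bool; true; false; _∧_; _∨_; _xor_; not)
open import Data.Fin as F using (Fin; toℕ; splitAt; remQuot)
open import Data.Fin.Subset using (Subset; _∈_; _⊆_; ∣_∣)
open import Data.Vec using (lookup)
open import Data.Sum using (_⊎_; inj₁; inj₂)
open import Data.Product using (Σ; _×_; _,_; ∃)
open import Data.List using (List; length; []; _∷_)
open import Relation.Binary.PropositionalEquality using (_≡_; _≢_)
open import Relation.Nullary using (¬_; ⌊_⌋)

record Graph : Set where
  constructor mkGraph
  field
    n   : ℕ
    adj : Fin n → Fin n → Bool
open Graph public

-- The graph K^s_{s,N}: the s-subdivision of K_{s,N}.

-- Vertex kinds: left i (i < s), right j (j < N), and the s internal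
-- vertices mid i j k (k < s) of the path subdividing the edge {left i, right j}.
data Vtx (s N : ℕ) : Set where
  left  : Fin s → Vtx s N
  right : Fin N → Vtx s N
  mid   : Fin s → Fin N → Fin s → Vtx s N

_=ᶠ_ : ∀ {m} → Fin m → Fin m → Bool
a =ᶠ b = ⌊ a F.≟ b ⌋

-- directed "next along the path" relation:
-- left i → mid i j 0 → mid i j 1 → … → mid i j (s-1) → right j
arc : ∀ {s N} → Vtx s N → Vtx s N → Bool
arc (left i)      (mid i' j k)   = (i =ᶠ i') ∧ (toℕ k ≡ᵇ 0)
arc {s} (mid i j k) (mid i' j' k') = (i =ᶠ i') ∧ (j =ᶠ j') ∧ (toℕ k' ≡ᵇ suc (toℕ k))
arc {s} (mid i j k) (right j')   = (j =ᶠ j') ∧ (suc (toℕ k) ≡ᵇ s)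
arc _ _ = false

adjV : ∀ {s N} → Vtx s N → Vtx s N → Bool
adjV u v = arc u v ∨ arc v u

nK : ℕ → ℕ → ℕ
nK s N = s + (N + (s * N) * s)

decode : ∀ s N → Fin (nK s N) → Vtx s N
decode s N x with splitAt s x
... | inj₁ i = left i
... | inj₂ y with splitAt N y
...   | inj₁ j = right j
...   | inj₂ z with remQuot {s * N} s z
...     | (e , k) with remQuot {s} N e
...       | (i , j) = mid i j k

SubdivK : ℕ → ℕ → Graph
SubdivK s N = mkGraph (nK s N) (λ u v → adjV (decode s N u) (decode s N v))

Flip : ℕ → Set
Flip n = Subset n × Subset n

_∈ᵇ_ : ∀ {n} → Fin n → Subset n → Bool
x ∈ᵇ A = lookup A x

flipAdj : ∀ {k} → (Fin k → Fin k → Bool) → Flip k → Fin k → Fin k → Bool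
flipAdj E (A , B) u v =
  E u v xor (((u ∈ᵇ A ∧ v ∈ᵇ B) ∨ (u ∈ᵇ B ∧ v ∈ᵇ A)) ∧ not (u =ᶠ v))

flipsAdj : ∀ {k} → (Fin k → Fin k → Bool) → List (Flip k) → Fin k → Fin k → Bool
flipsAdj E [] = E
flipsAdj E (F ∷ Fs) = flipsAdj (flipAdj E F) Fs

flipAll : (G : Graph) → List (Flip (n G)) → Graph
flipAll G Fs = mkGraph (n G) (flipsAdj (adj G) Fs)

data Within (G : Graph) : ℕ → Fin (n G) → Fin (n G) → Set where
  here : ∀ {r u} → Within G r u u
  step : ∀ {r u w v} → adj G u w ≡ true → Within G r w v → Within G (suc r) u v

Independent : (G : Graph) → ℕ → Subset (n G) → Set
Independent G r B = ∀ u v → u ∈ B → v ∈ B → u ≢ v → ¬ Within G r u v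

StronglyFlipFlat : (Graph → Set) → Set
StronglyFlipFlat 𝒞 =
  Σ ℕ λ s₀ → ∀ (r : ℕ) → Σ (ℕ → ℕ) λ Nr →
    ∀ (m : ℕ) (G : Graph) → 𝒞 G → (A : Subset (n G)) → Nr m ≤ ∣ A ∣ →
      Σ (List (Flip (n G))) λ 𝓕 → length 𝓕 ≤ s₀ ×
        Σ (Subset (n G)) λ B → B ⊆ A × m ≤ ∣ B ∣ × Independent (flipAll G 𝓕) r B

SubdivKClass : Graph → Set
SubdivKClass G = Σ ℕ λ s → Σ ℕ λ N → G ≡ SubdivK s N

-- Fix s₀ flips. The type of a vertex (its membership in both sides of every flip) takes at most
-- q = 4 ^ s₀ values, and the flips toggle the adjacency of two distinct vertices according to their
-- types alone. In K^s_{s,N} with s > q two left vertices i₁ and i₂ share a type, and among more than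
-- q ^ (s + 1) right vertices there are two, j₁ and j₂, whose subdivision paths from i₁ have equal
-- types level by level. At each level the flips then keep both path edges or replace them by both
-- cross edges, and i₁ or i₂ is a common neighbour of the first vertices of the two paths. Hence j₁
-- and j₂ stay at distance at most 2s + 2 however the s₀ flips are chosen.
module Submission where

open import Defs
open import Data.Bool using (Bool; true; false; _∧_; _∨_; _xor_; not)
open import Data.Bool.Properties using (∨-comm; ∧-comm; ∨-zeroʳ; xor-assoc; xor-identityʳ; T-≡)
open import Data.Empty using (⊥-elim)
open import Data.Fin as F using (Fin; toℕ; fromℕ<; inject≤; combine; splitAt; remQuot; _↑ˡ_; _↑ʳ_; funToFin; finToFun)
import Data.Fin.Properties as FP
open import Data.Fin.Subset using (Subset; _∈_; _⊆_; ∣_∣; ⊤; ⊥)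
open import Data.Fin.Subset.Properties using (∉⊥; ∣⊤∣≡n; ∣⊥∣≡0)
open import Data.List using (List; length; []; _∷_)
open import Data.Nat using (ℕ; zero; suc; _+_; _*_; _^_; _≤_; _<_; _≡ᵇ_; z≤n; s≤s; _<?_)
open import Data.Nat.Properties
open import Data.Product using (Σ; ∃; ∃₂; _×_; _,_; proj₁; proj₂)
open import Data.Sum using (_⊎_; inj₁; inj₂; [_,_]′)
open import Data.Vec using (_∷_; []; _++_; lookup; here; there)
open import Data.Vec.Properties using (lookup-splitAt; lookup⇒[]=; []=⇒lookup)
open import Function using (_∘_; Equivalence)
open import Relation.Nullary using (¬_; yes; no)
open import Relation.Nullary.Decidable using (isYes≗does; dec-true; dec-false)
open import Relation.Binary.PropositionalEquality

=ᶠ-refl : ∀ {m} (a : Fin m) → (a =ᶠ a) ≡ true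
=ᶠ-refl a = trans (isYes≗does (a F.≟ a)) (dec-true (a F.≟ a) refl)

=ᶠ-≢ : ∀ {m} {a b : Fin m} → a ≢ b → (a =ᶠ b) ≡ false
=ᶠ-≢ {a = a} {b} a≢b = trans (isYes≗does (a F.≟ b)) (dec-false (a F.≟ b) a≢b)

=ᶠ-sym : ∀ {m} (a b : Fin m) → (a =ᶠ b) ≡ (b =ᶠ a)
=ᶠ-sym a b with a F.≟ b
... | yes refl = sym (=ᶠ-refl a)
... | no a≢b = sym (=ᶠ-≢ (a≢b ∘ sym))

≡ᵇ-refl : ∀ m → (m ≡ᵇ m) ≡ true
≡ᵇ-refl m = Equivalence.to T-≡ (≡⇒≡ᵇ m m refl)

module _ (G : Graph) where

  Within-mono : ∀ {r r′ u v} → r ≤ r′ → Within G r u v → Within G r′ u v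
  Within-mono _ here = here
  Within-mono (s≤s r≤r′) (step e w) = step e (Within-mono r≤r′ w)

  Within-++ : ∀ {a b u w v} → Within G a u w → Within G b w v → Within G (a + b) u v
  Within-++ {a} {b} here w₂ = Within-mono (m≤n+m b a) w₂
  Within-++ (step e w₁) w₂ = step e (Within-++ w₁ w₂)

  Within-snoc : ∀ {r u w v} → Within G r u w → adj G w v ≡ true → Within G (suc r) u v
  Within-snoc here e = step e here
  Within-snoc (step e′ w) e = step e′ (Within-snoc w e)

  Within-reverse : (∀ u v → adj G u v ≡ adj G v u) → ∀ {r u v} → Within G r u v → Within G r v u
  Within-reverse adj-sym here = here
  Within-reverse adj-sym {u = u} (step {w = w} e walk) =
    Within-snoc (Within-reverse adj-sym walk) (trans (adj-sym w u) e)

xor-dichotomy : ∀ t {p q p′ q′} → p ≡ true xor t → q ≡ true xor t → p′ ≡ false xor t → q′ ≡ false xor t →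
  (p ≡ true × q ≡ true) ⊎ (p′ ≡ true × q′ ≡ true)
xor-dichotomy false p q _ _ = inj₁ (p , q)
xor-dichotomy true _ _ p′ q′ = inj₂ (p′ , q′)

module _ {k : ℕ} where

  flipToggle : Flip k → Fin k → Fin k → Bool
  flipToggle (A , B) u v = ((u ∈ᵇ A ∧ v ∈ᵇ B) ∨ (u ∈ᵇ B ∧ v ∈ᵇ A)) ∧ not (u =ᶠ v)

  toggle : List (Flip k) → Fin k → Fin k → Bool
  toggle [] u v = false
  toggle (F ∷ Fs) u v = flipToggle F u v xor toggle Fs u v

  flipsAdj-toggle : ∀ Fs (E : Fin k → Fin k → Bool) u v → flipsAdj E Fs u v ≡ E u v xor toggle Fs u v
  flipsAdj-toggle [] E u v = sym (xor-identityʳ (E u v))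
  flipsAdj-toggle (F ∷ Fs) E u v =
    trans (flipsAdj-toggle Fs (flipAdj E F) u v) (xor-assoc (E u v) (flipToggle F u v) (toggle Fs u v))

  flipToggle-sym : ∀ F u v → flipToggle F u v ≡ flipToggle F v u
  flipToggle-sym (A , B) u v rewrite =ᶠ-sym u v =
    cong (_∧ not (v =ᶠ u)) (trans (∨-comm (u ∈ᵇ A ∧ v ∈ᵇ B) _) (cong₂ _∨_ (∧-comm (u ∈ᵇ B) _) (∧-comm (u ∈ᵇ A) _)))

  toggle-sym : ∀ Fs u v → toggle Fs u v ≡ toggle Fs v u
  toggle-sym [] u v = refl
  toggle-sym (F ∷ Fs) u v = cong₂ _xor_ (flipToggle-sym F u v) (toggle-sym Fs u v)

  flipsAdj-sym : ∀ Fs (E : Fin k → Fin k → Bool) → (∀ u v → E u v ≡ E v u) →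
    ∀ u v → flipsAdj E Fs u v ≡ flipsAdj E Fs v u
  flipsAdj-sym Fs E E-sym u v = begin
    flipsAdj E Fs u v        ≡⟨ flipsAdj-toggle Fs E u v ⟩
    E u v xor toggle Fs u v  ≡⟨ cong₂ _xor_ (E-sym u v) (toggle-sym Fs u v) ⟩
    E v u xor toggle Fs v u  ≡⟨ flipsAdj-toggle Fs E v u ⟨
    flipsAdj E Fs v u        ∎
    where open ≡-Reasoning

  bitFin : Bool → Fin 2
  bitFin false = F.zero
  bitFin true = F.suc F.zero

  bitFin-injective : ∀ {a b} → bitFin a ≡ bitFin b → a ≡ b
  bitFin-injective {false} {false} _ = refl
  bitFin-injective {true} {true} _ = refl

  membershipType : Flip k → Fin k → Fin 4
  membershipType (A , B) u = combine (bitFin (u ∈ᵇ A)) (bitFin (u ∈ᵇ B))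

  flipType : (Fs : List (Flip k)) → Fin k → Fin (4 ^ length Fs)
  flipType [] u = F.zero
  flipType (F ∷ Fs) u = combine (membershipType F u) (flipType Fs u)

  membershipType-injective : ∀ A B {u u′} → membershipType (A , B) u ≡ membershipType (A , B) u′ →
    u ∈ᵇ A ≡ u′ ∈ᵇ A × u ∈ᵇ B ≡ u′ ∈ᵇ B
  membershipType-injective A B {u} {u′} t =
    bitFin-injective (FP.combine-injectiveˡ (bitFin (u ∈ᵇ A)) (bitFin (u ∈ᵇ B)) _ (bitFin (u′ ∈ᵇ B)) t) ,
    bitFin-injective (FP.combine-injectiveʳ (bitFin (u ∈ᵇ A)) _ (bitFin (u′ ∈ᵇ A)) _ t)

  flipToggle-respects-type : ∀ F {u u′ v v′} → membershipType F u ≡ membershipType F u′ →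
    membershipType F v ≡ membershipType F v′ → u ≢ v → u′ ≢ v′ → flipToggle F u v ≡ flipToggle F u′ v′
  flipToggle-respects-type (A , B) tu tv u≢v u′≢v′
    with membershipType-injective A B tu | membershipType-injective A B tv
  ... | uA , uB | vA , vB =
    cong₂ _∧_ (cong₂ _∨_ (cong₂ _∧_ uA vB) (cong₂ _∧_ uB vA)) (cong not (trans (=ᶠ-≢ u≢v) (sym (=ᶠ-≢ u′≢v′))))

  flipType-∷-injective : ∀ F Fs {u u′} → flipType (F ∷ Fs) u ≡ flipType (F ∷ Fs) u′ →
    membershipType F u ≡ membershipType F u′ × flipType Fs u ≡ flipType Fs u′
  flipType-∷-injective F Fs {u} {u′} t =
    FP.combine-injectiveˡ (membershipType F u) (flipType Fs u) (membershipType F u′) (flipType Fs u′) t ,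
    FP.combine-injectiveʳ (membershipType F u) (flipType Fs u) (membershipType F u′) (flipType Fs u′) t

  toggle-respects-type : ∀ Fs {u u′ v v′} → flipType Fs u ≡ flipType Fs u′ → flipType Fs v ≡ flipType Fs v′ →
    u ≢ v → u′ ≢ v′ → toggle Fs u v ≡ toggle Fs u′ v′
  toggle-respects-type [] _ _ _ _ = refl
  toggle-respects-type (F ∷ Fs) tu tv u≢v u′≢v′
    with flipType-∷-injective F Fs tu | flipType-∷-injective F Fs tv
  ... | tuF , tuFs | tvF , tvFs =
    cong₂ _xor_ (flipToggle-respects-type F tuF tvF u≢v u′≢v′) (toggle-respects-type Fs tuFs tvFs u≢v u′≢v′)

  flipsAdj-by-type : ∀ Fs (E : Fin k → Fin k → Bool) {u u′ v v′ b} →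
    flipType Fs u ≡ flipType Fs u′ → flipType Fs v ≡ flipType Fs v′ → u ≢ v → u′ ≢ v′ →
    E u′ v′ ≡ b → flipsAdj E Fs u′ v′ ≡ b xor toggle Fs u v
  flipsAdj-by-type Fs E tu tv u≢v u′≢v′ e =
    trans (flipsAdj-toggle Fs E _ _) (cong₂ _xor_ e (toggle-respects-type Fs (sym tu) (sym tv) u′≢v′ u≢v))

  flipped-rungs : ∀ Fs (E : Fin k → Fin k → Bool) {a₁ a₂ b₁ b₂} →
    flipType Fs a₁ ≡ flipType Fs a₂ → flipType Fs b₁ ≡ flipType Fs b₂ →
    E a₁ b₁ ≡ true → E a₂ b₂ ≡ true → E a₁ b₂ ≡ false → E a₂ b₁ ≡ false →
    a₁ ≢ b₁ → a₂ ≢ b₂ → a₁ ≢ b₂ → a₂ ≢ b₁ →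
    (flipsAdj E Fs a₁ b₁ ≡ true × flipsAdj E Fs a₂ b₂ ≡ true) ⊎
    (flipsAdj E Fs a₁ b₂ ≡ true × flipsAdj E Fs a₂ b₁ ≡ true)
  flipped-rungs Fs E {a₁} {a₂} {b₁} {b₂} ta tb e₁₁ e₂₂ e₁₂ e₂₁ d₁₁ d₂₂ d₁₂ d₂₁ =
    xor-dichotomy (toggle Fs _ _)
      (by refl refl d₁₁ e₁₁) (by ta tb d₂₂ e₂₂) (by refl tb d₁₂ e₁₂) (by ta refl d₂₁ e₂₁)
    where
    by : ∀ {u v b} → flipType Fs a₁ ≡ flipType Fs u → flipType Fs b₁ ≡ flipType Fs v → u ≢ v →
      E u v ≡ b → flipsAdj E Fs u v ≡ b xor toggle Fs a₁ b₁
    by tu tv = flipsAdj-by-type Fs E tu tv d₁₁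

  flipped-commonNeighbour : ∀ Fs (E : Fin k → Fin k → Bool) {a a′ v w} →
    flipType Fs a ≡ flipType Fs a′ → flipType Fs v ≡ flipType Fs w →
    E a v ≡ true → E a w ≡ true → E a′ v ≡ false → E a′ w ≡ false →
    a ≢ v → a ≢ w → a′ ≢ v → a′ ≢ w →
    Σ (Fin k) λ c → flipsAdj E Fs c v ≡ true × flipsAdj E Fs c w ≡ true
  flipped-commonNeighbour Fs E {a} {a′} {v} {w} ta tv e₁ e₂ e₃ e₄ d₁ d₂ d₃ d₄ =
    [ (a ,_) , (a′ ,_) ]′
      (xor-dichotomy (toggle Fs a v) (by refl refl d₁ e₁) (by refl tv d₂ e₂) (by ta refl d₃ e₃) (by ta tv d₄ e₄))
    where
    by : ∀ {u x b} → flipType Fs a ≡ flipType Fs u → flipType Fs v ≡ flipType Fs x → u ≢ x →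
      E u x ≡ b → flipsAdj E Fs u x ≡ b xor toggle Fs a v
    by tu tx = flipsAdj-by-type Fs E tu tx d₁

module _ (G : Graph) (v w : ℕ → Fin (n G)) where

  Rung : ℕ → Set
  Rung k = (adj G (v (suc k)) (v k) ≡ true × adj G (w (suc k)) (w k) ≡ true) ⊎
           (adj G (v (suc k)) (w k) ≡ true × adj G (w (suc k)) (v k) ≡ true)

  ladder : ∀ L → (∀ k → k < L → Rung k) →
    (Within G L (v L) (v 0) × Within G L (w L) (w 0)) ⊎ (Within G L (v L) (w 0) × Within G L (w L) (v 0))
  ladder zero _ = inj₁ (here , here)
  ladder (suc L) rungs with ladder L (λ k k<L → rungs k (m<n⇒m<1+n k<L)) | rungs L (n<1+n L)
  ... | inj₁ (p , q) | inj₁ (e , f) = inj₁ (step e p , step f q)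
  ... | inj₁ (p , q) | inj₂ (e , f) = inj₂ (step e q , step f p)
  ... | inj₂ (p , q) | inj₁ (e , f) = inj₂ (step e p , step f q)
  ... | inj₂ (p , q) | inj₂ (e , f) = inj₁ (step e q , step f p)

  ladder-closed : (∀ x y → adj G x y ≡ adj G y x) → ∀ L → (∀ k → k < L → Rung k) →
    ∀ c → adj G c (v 0) ≡ true → adj G c (w 0) ≡ true → Within G (L + suc (suc L)) (v L) (w L)
  ladder-closed adj-sym L rungs c cv cw with ladder L rungs
  ... | inj₁ (p , q) =
    Within-++ G p (step (trans (adj-sym _ c) cv) (step cw (Within-reverse G adj-sym q)))
  ... | inj₂ (p , q) =
    Within-++ G p (step (trans (adj-sym _ c) cw) (step cv (Within-reverse G adj-sym q)))

adjV-sym : ∀ {s N} (u v : Vtx s N) → adjV u v ≡ adjV v u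
adjV-sym u v = ∨-comm (arc u v) (arc v u)

module _ {s N : ℕ} where

  encode : Vtx s N → Fin (nK s N)
  encode (left i) = i ↑ˡ (N + (s * N) * s)
  encode (right j) = s ↑ʳ (j ↑ˡ ((s * N) * s))
  encode (mid i j k) = s ↑ʳ (N ↑ʳ combine (combine i j) k)

  decode-encode : ∀ v → decode s N (encode v) ≡ v
  decode-encode (left i) rewrite FP.splitAt-↑ˡ s i (N + (s * N) * s) = refl
  decode-encode (right j)
    rewrite FP.splitAt-↑ʳ s (N + (s * N) * s) (j ↑ˡ ((s * N) * s))
          | FP.splitAt-↑ˡ N j ((s * N) * s) = refl
  decode-encode (mid i j k)
    rewrite FP.splitAt-↑ʳ s (N + (s * N) * s) (N ↑ʳ combine (combine i j) k)
          | FP.splitAt-↑ʳ N ((s * N) * s) (combine (combine i j) k) =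
    trans (cong (λ p → mid (proj₁ (remQuot {s} N (proj₁ p))) (proj₂ (remQuot {s} N (proj₁ p))) (proj₂ p))
                (FP.remQuot-combine {s * N} {s} (combine i j) k))
          (cong (λ q → mid (proj₁ q) (proj₂ q) k) (FP.remQuot-combine {s} {N} i j))

  encode-injective : ∀ {u v} → encode u ≡ encode v → u ≡ v
  encode-injective {u} {v} e = trans (sym (decode-encode u)) (trans (cong (decode s N) e) (decode-encode v))

  adj-encode : ∀ u v → adj (SubdivK s N) (encode u) (encode v) ≡ adjV u v
  adj-encode u v rewrite decode-encode u | decode-encode v = refl

SubdivK-sym : ∀ s N (x y : Fin (nK s N)) → adj (SubdivK s N) x y ≡ adj (SubdivK s N) y x
SubdivK-sym s N x y = adjV-sym (decode s N x) (decode s N y)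

∣++∣ : ∀ {m n} (p : Subset m) (q : Subset n) → ∣ p ++ q ∣ ≡ ∣ p ∣ + ∣ q ∣
∣++∣ [] q = refl
∣++∣ (true ∷ p) q = cong suc (∣++∣ p q)
∣++∣ (false ∷ p) q = ∣++∣ p q

∈-++⁻ : ∀ {m n} (p : Subset m) (q : Subset n) {x} → x ∈ p ++ q →
  (∃ λ i → i ∈ p × i ↑ˡ n ≡ x) ⊎ (∃ λ j → j ∈ q × m ↑ʳ j ≡ x)
∈-++⁻ {m} p q {x} x∈p++q with splitAt m x in eq | lookup-splitAt m p q x
... | inj₁ i | lookup≡ = inj₁ (i , lookup⇒[]= i p (trans (sym lookup≡) ([]=⇒lookup x∈p++q)) , FP.splitAt⁻¹-↑ˡ eq)
... | inj₂ j | lookup≡ = inj₂ (j , lookup⇒[]= j q (trans (sym lookup≡) ([]=⇒lookup x∈p++q)) , FP.splitAt⁻¹-↑ʳ eq)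

members : ∀ {n} (p : Subset n) → Fin ∣ p ∣ → Fin n
members (true ∷ p) F.zero = F.zero
members (true ∷ p) (F.suc i) = F.suc (members p i)
members (false ∷ p) i = F.suc (members p i)

members-∈ : ∀ {n} (p : Subset n) i → members p i ∈ p
members-∈ (true ∷ p) F.zero = here
members-∈ (true ∷ p) (F.suc i) = there (members-∈ p i)
members-∈ (false ∷ p) i = there (members-∈ p i)

members-injective : ∀ {n} (p : Subset n) {i j} → members p i ≡ members p j → i ≡ j
members-injective (true ∷ p) {F.zero} {F.zero} _ = refl
members-injective (true ∷ p) {F.suc i} {F.suc j} eq = cong F.suc (members-injective p (FP.suc-injective eq))
members-injective (false ∷ p) eq = members-injective p (FP.suc-injective eq)

rights : ∀ s N → Subset (nK s N)
rights s N = ⊥ {s} ++ (⊤ {N} ++ ⊥ {(s * N) * s})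

∣rights∣ : ∀ s N → ∣ rights s N ∣ ≡ N
∣rights∣ s N = begin
  ∣ rights s N ∣                           ≡⟨ ∣++∣ (⊥ {s}) (⊤ {N} ++ ⊥ {(s * N) * s}) ⟩
  ∣ ⊥ {s} ∣ + ∣ ⊤ {N} ++ ⊥ {(s * N) * s} ∣ ≡⟨ cong₂ _+_ (∣⊥∣≡0 s) (∣++∣ (⊤ {N}) (⊥ {(s * N) * s})) ⟩
  ∣ ⊤ {N} ∣ + ∣ ⊥ {(s * N) * s} ∣          ≡⟨ cong₂ _+_ (∣⊤∣≡n N) (∣⊥∣≡0 ((s * N) * s)) ⟩
  N + 0                                    ≡⟨ +-identityʳ N ⟩
  N                                        ∎
  where open ≡-Reasoning

∈rights⇒right : ∀ {s N x} → x ∈ rights s N → ∃ λ j → encode (right j) ≡ x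
∈rights⇒right {s} {N} x∈ with ∈-++⁻ (⊥ {s}) (⊤ {N} ++ ⊥ {(s * N) * s}) x∈
... | inj₁ (_ , i∈⊥ , _) = ⊥-elim (∉⊥ i∈⊥)
... | inj₂ (y , y∈ , sy≡x) with ∈-++⁻ (⊤ {N}) (⊥ {(s * N) * s}) y∈
...   | inj₁ (j , _ , jN≡y) = j , trans (cong (s ↑ʳ_) jN≡y) sy≡x
...   | inj₂ (_ , z∈⊥ , _) = ⊥-elim (∉⊥ z∈⊥)

module _ {s N : ℕ} where

  level : Vtx s N → ℕ
  level (left _) = 0
  level (right _) = s
  level (mid _ _ k) = toℕ k

  pathVtx : Fin s → Fin N → ℕ → Vtx s N
  pathVtx i j k with k <? s
  ... | yes k<s = mid i j (fromℕ< k<s)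
  ... | no _ = right j

  level-pathVtx : ∀ i j k → k ≤ s → level (pathVtx i j k) ≡ k
  level-pathVtx i j k k≤s with k <? s
  ... | yes k<s = FP.toℕ-fromℕ< k<s
  ... | no k≮s = ≤-antisym (≮⇒≥ k≮s) k≤s

  pathVtx-top : ∀ i j → pathVtx i j s ≡ right j
  pathVtx-top i j with s <? s
  ... | yes s<s = ⊥-elim (<-irrefl refl s<s)
  ... | no _ = refl

  pathVtx-≢ : ∀ i j j′ k → k < s → pathVtx i j (suc k) ≢ pathVtx i j′ k
  pathVtx-≢ i j j′ k k<s eq = <-irrefl (sym levels) (n<1+n k)
    where
    levels : suc k ≡ k
    levels = begin
      suc k                        ≡⟨ level-pathVtx i j (suc k) k<s ⟨
      level (pathVtx i j (suc k))  ≡⟨ cong level eq ⟩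
      level (pathVtx i j′ k)       ≡⟨ level-pathVtx i j′ k (<⇒≤ k<s) ⟩
      k                            ∎
      where open ≡-Reasoning

  left≢pathVtx : ∀ i′ i j k → left i′ ≢ pathVtx i j k
  left≢pathVtx i′ i j k with k <? s
  ... | yes _ = λ ()
  ... | no _ = λ ()

  pathVtx-rung : ∀ i j k → k < s → adjV (pathVtx i j (suc k)) (pathVtx i j k) ≡ true
  pathVtx-rung i j k k<s with suc k <? s | k <? s
  ... | _ | no k≮s = ⊥-elim (k≮s k<s)
  ... | yes sk<s | yes k<s′
    rewrite =ᶠ-refl i | =ᶠ-refl j | FP.toℕ-fromℕ< sk<s | FP.toℕ-fromℕ< k<s′ | ≡ᵇ-refl k = ∨-zeroʳ _
  ... | no sk≮s | yes k<s′
    rewrite =ᶠ-refl j | FP.toℕ-fromℕ< k<s′ | ≤-antisym (≮⇒≥ sk≮s) k<s = ≡ᵇ-refl (suc k)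

  pathVtx-cross : ∀ i j j′ k → j ≢ j′ → k < s → adjV (pathVtx i j (suc k)) (pathVtx i j′ k) ≡ false
  pathVtx-cross i j j′ k j≢j′ k<s with suc k <? s | k <? s
  ... | _ | no k≮s = ⊥-elim (k≮s k<s)
  ... | yes _ | yes _ rewrite =ᶠ-refl i | =ᶠ-≢ j≢j′ | =ᶠ-≢ (j≢j′ ∘ sym) = refl
  ... | no _ | yes _ rewrite =ᶠ-≢ (j≢j′ ∘ sym) = refl

  left-adj-pathVtx₀ : ∀ i j → adjV (left i) (pathVtx i j 0) ≡ true
  left-adj-pathVtx₀ i j with 0 <? s
  ... | no 0≮s = ⊥-elim (0≮s (≤-<-trans z≤n (FP.toℕ<n i)))
  ... | yes 0<s rewrite =ᶠ-refl i | FP.toℕ-fromℕ< 0<s = refl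

  left-nonadj-pathVtx : ∀ i′ i j k → i′ ≢ i → adjV (left i′) (pathVtx i j k) ≡ false
  left-nonadj-pathVtx i′ i j k i′≢i with k <? s
  ... | yes _ rewrite =ᶠ-≢ i′≢i = refl
  ... | no _ = refl

funToFin-injective : ∀ {m n} (f g : Fin m → Fin n) → funToFin f ≡ funToFin g → ∀ i → f i ≡ g i
funToFin-injective f g eq i =
  trans (sym (FP.finToFun-funToFin f i)) (trans (cong (λ c → finToFun c i) eq) (FP.finToFun-funToFin g i))

pigeonhole-typeSequences : ∀ {k m} (Fs : List (Flip k)) {q} d → 4 ^ length Fs ≤ q → q ^ d < m →
  (g : Fin m → ℕ → Fin k) → ∃₂ λ a b → a ≢ b × (∀ l → l < d → flipType Fs (g a l) ≡ flipType Fs (g b l))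
pigeonhole-typeSequences {k} {m} Fs {q} d 4^ℓ≤q q^d<m g =
  let a , b , a<b , same = FP.pigeonhole q^d<m signature
  in a , b , FP.<⇒≢ a<b , λ l l<d →
       FP.inject≤-injective _ _ _ _
         (subst (λ l′ → type (g a l′) ≡ type (g b l′)) (FP.toℕ-fromℕ< l<d) (funToFin-injective (typesAlong a) (typesAlong b) same (fromℕ< l<d)))
  where
  type : Fin k → Fin q
  type u = inject≤ (flipType Fs u) 4^ℓ≤q

  typesAlong : Fin m → Fin d → Fin q
  typesAlong a l = type (g a (toℕ l))

  signature : Fin m → Fin (q ^ d)
  signature a = funToFin (typesAlong a)

ladderWalk : ∀ {s N} (Fs : List (Flip (nK s N))) {i₁ i₂ : Fin s} {j₁ j₂ : Fin N} → i₁ ≢ i₂ → j₁ ≢ j₂ →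
  flipType Fs (encode (left i₁)) ≡ flipType Fs (encode (left i₂)) →
  (∀ k → k ≤ s → flipType Fs (encode (pathVtx i₁ j₁ k)) ≡ flipType Fs (encode (pathVtx i₁ j₂ k))) →
  Within (flipAll (SubdivK s N) Fs) (s + suc (suc s)) (encode (right {s} j₁)) (encode (right {s} j₂))
ladderWalk {s} {N} Fs {i₁} {i₂} {j₁} {j₂} i₁≢i₂ j₁≢j₂ twinLefts twinPaths =
  subst₂ (Within G′ (s + suc (suc s))) (cong (encode {s} {N}) (pathVtx-top i₁ j₁)) (cong (encode {s} {N}) (pathVtx-top i₁ j₂))
    (ladder-closed G′ v w (flipsAdj-sym Fs E (SubdivK-sym s N)) s rung c cv cw)
  where
  E : Fin (nK s N) → Fin (nK s N) → Bool
  E = adj (SubdivK s N)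

  G′ : Graph
  G′ = flipAll (SubdivK s N) Fs

  v w : ℕ → Fin (nK s N)
  v k = encode (pathVtx i₁ j₁ k)
  w k = encode (pathVtx i₁ j₂ k)

  adjE : ∀ (x y : Vtx s N) {b} → adjV x y ≡ b → E (encode x) (encode y) ≡ b
  adjE x y e = trans (adj-encode x y) e

  encode-≢ : ∀ (x y : Vtx s N) → x ≢ y → encode x ≢ encode y
  encode-≢ x y x≢y = x≢y ∘ encode-injective

  P : Fin N → ℕ → Vtx s N
  P = pathVtx i₁

  rung : ∀ k → k < s → Rung G′ v w k
  rung k k<s = flipped-rungs Fs E (twinPaths (suc k) k<s) (twinPaths k (<⇒≤ k<s))
    (adjE (P j₁ (suc k)) (P j₁ k) (pathVtx-rung i₁ j₁ k k<s))
    (adjE (P j₂ (suc k)) (P j₂ k) (pathVtx-rung i₁ j₂ k k<s))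
    (adjE (P j₁ (suc k)) (P j₂ k) (pathVtx-cross i₁ j₁ j₂ k j₁≢j₂ k<s))
    (adjE (P j₂ (suc k)) (P j₁ k) (pathVtx-cross i₁ j₂ j₁ k (j₁≢j₂ ∘ sym) k<s))
    (encode-≢ (P j₁ (suc k)) (P j₁ k) (pathVtx-≢ i₁ j₁ j₁ k k<s))
    (encode-≢ (P j₂ (suc k)) (P j₂ k) (pathVtx-≢ i₁ j₂ j₂ k k<s))
    (encode-≢ (P j₁ (suc k)) (P j₂ k) (pathVtx-≢ i₁ j₁ j₂ k k<s))
    (encode-≢ (P j₂ (suc k)) (P j₁ k) (pathVtx-≢ i₁ j₂ j₁ k k<s))

  commonNeighbour : Σ (Fin (nK s N)) λ c → adj G′ c (v 0) ≡ true × adj G′ c (w 0) ≡ true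
  commonNeighbour = flipped-commonNeighbour Fs E twinLefts (twinPaths 0 z≤n)
    (adjE (left i₁) (P j₁ 0) (left-adj-pathVtx₀ i₁ j₁))
    (adjE (left i₁) (P j₂ 0) (left-adj-pathVtx₀ i₁ j₂))
    (adjE (left i₂) (P j₁ 0) (left-nonadj-pathVtx i₂ i₁ j₁ 0 (i₁≢i₂ ∘ sym)))
    (adjE (left i₂) (P j₂ 0) (left-nonadj-pathVtx i₂ i₁ j₂ 0 (i₁≢i₂ ∘ sym)))
    (encode-≢ (left i₁) (P j₁ 0) (left≢pathVtx i₁ i₁ j₁ 0))
    (encode-≢ (left i₁) (P j₂ 0) (left≢pathVtx i₁ i₁ j₂ 0))
    (encode-≢ (left i₂) (P j₁ 0) (left≢pathVtx i₂ i₁ j₁ 0))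
    (encode-≢ (left i₂) (P j₂ 0) (left≢pathVtx i₂ i₁ j₂ 0))

  c = proj₁ commonNeighbour
  cv = proj₁ (proj₂ commonNeighbour)
  cw = proj₂ (proj₂ commonNeighbour)

closeRightVertices : ∀ {s N} (Fs : List (Flip (nK s N))) q → 4 ^ length Fs ≤ q → q < s →
  (B : Subset (nK s N)) → B ⊆ rights s N → q ^ suc s < ∣ B ∣ →
  Σ (Fin (nK s N)) λ y₁ → Σ (Fin (nK s N)) λ y₂ →
    y₁ ∈ B × y₂ ∈ B × y₁ ≢ y₂ × Within (flipAll (SubdivK s N) Fs) (s + suc (suc s)) y₁ y₂
closeRightVertices {s} {N} Fs q 4^ℓ≤q q<s B B⊆rights q^[1+s]<∣B∣ =
  let i₁ , i₂ , i₁≢i₂ , twinLefts = pigeonhole-typeSequences Fs 1 4^ℓ≤q (subst (_< s) (sym (^-identityʳ q)) q<s)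
                                      (λ i _ → encode (left i))
      a , b , a≢b , twinPaths = pigeonhole-typeSequences Fs (suc s) 4^ℓ≤q q^[1+s]<∣B∣
                                  (λ a → encode ∘ pathVtx i₁ (rightIndex a))
  in members B a , members B b , members-∈ B a , members-∈ B b , a≢b ∘ members-injective B ,
     subst₂ (Within _ _) (encode-rightIndex a) (encode-rightIndex b)
       (ladderWalk Fs i₁≢i₂ (a≢b ∘ rightIndex-injective) (twinLefts 0 (s≤s z≤n)) (λ k k≤s → twinPaths k (s≤s k≤s)))
  where
  rightIndex : Fin ∣ B ∣ → Fin N
  rightIndex a = proj₁ (∈rights⇒right {s} {N} (B⊆rights (members-∈ B a)))

  encode-rightIndex : ∀ a → encode (right {s} (rightIndex a)) ≡ members B a
  encode-rightIndex a = proj₂ (∈rights⇒right {s} {N} (B⊆rights (members-∈ B a)))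

  rightIndex-injective : ∀ {a b} → rightIndex a ≡ rightIndex b → a ≡ b
  rightIndex-injective {a} {b} eq = members-injective B (begin
    members B a                       ≡⟨ encode-rightIndex a ⟨
    encode (right {s} (rightIndex a)) ≡⟨ cong (encode ∘ right {s}) eq ⟩
    encode (right {s} (rightIndex b)) ≡⟨ encode-rightIndex b ⟩
    members B b                       ∎)
    where open ≡-Reasoning

mainTheorem5 : ¬ StronglyFlipFlat SubdivKClass
mainTheorem5 (s₀ , flat) =
  let Nr , flat-r = flat r
      N = Nr m
      Fs , |Fs|≤s₀ , B , B⊆rights , m≤∣B∣ , independent =
        flat-r m (SubdivK s N) (s , N , refl) (rights s N) (≤-reflexive (sym (∣rights∣ s N)))
      y₁ , y₂ , y₁∈B , y₂∈B , y₁≢y₂ , close =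
        closeRightVertices {s} {N} Fs q (^-monoʳ-≤ 4 |Fs|≤s₀) ≤-refl B B⊆rights m≤∣B∣
  in independent y₁ y₂ y₁∈B y₂∈B y₁≢y₂ close
  where
  -- q bounds the number of flip types, s > q forces two left twins, m > q ^ (s + 1) forces two path twins
  q s r m : ℕ
  q = 4 ^ s₀
  s = suc q
  r = s + suc (suc s)
  m = suc (q ^ suc s)
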